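{- Let $X$ be a type and $x:X$. Then $x$ is isolated if and only if there is a type $Y$ and an equivalence $X\to Y+\mathbf{1}$ sending $x$ to $\mathrm{inr}(\star)$.
   Context: Work in intensional Martin-Löf type theory with $\Pi$-, $\Sigma$-, identity, finite types and natural numbers, and a universe closed under these; $=$ denotes the identity type and $a\neq b$ means $(a=b)\to\mathbf{0}$. A point $x:X$ is isolated if $\prod_{y:X}(x=y)+(x\neq y)$. An equivalence is a map with a left inverse and a right inverse. $\star$ is the element of the unit type $\mathbf{1}$. -}

{-# OPTIONS --without-K #-}
module Defs where

open import Level using (Level)
open import Data.Product using (Σ; _×_; _,_)
open import Data.Sum using (_⊎_; inj₁; inj₂)
open import Relation.Binary.PropositionalEquality using (_≡_)
open import Relation.Nullary using (¬_)

isIsolated : ∀ {ℓ} {X : Set ℓ} → X → Set ℓ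
isIsolated {X = X} x = (y : X) → (x ≡ y) ⊎ (¬ (x ≡ y))

hasLeftInverse : ∀ {ℓ ℓ'} {A : Set ℓ} {B : Set ℓ'} → (A → B) → Set (ℓ Level.⊔ ℓ')
hasLeftInverse {A = A} {B} f = Σ (B → A) (λ g → (a : A) → g (f a) ≡ a)

hasRightInverse : ∀ {ℓ ℓ'} {A : Set ℓ} {B : Set ℓ'} → (A → B) → Set (ℓ Level.⊔ ℓ')
hasRightInverse {A = A} {B} f = Σ (B → A) (λ h → (b : B) → f (h b) ≡ b)

isEquiv : ∀ {ℓ ℓ'} {A : Set ℓ} {B : Set ℓ'} → (A → B) → Set (ℓ Level.⊔ ℓ')
isEquiv f = hasLeftInverse f × hasRightInverse f

{-# OPTIONS --without-K #-}
module Submission where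

open import Defs
open import Data.Bool.Properties using (T-irrelevant)
open import Data.Product using (Σ; _×_; _,_; proj₁)
open import Data.Sum using (_⊎_; inj₁; inj₂)
open import Data.Unit.Polymorphic using (⊤; tt)
open import Function using (_∘_)
open import Function.Bundles using (_⇔_; mk⇔)
open import Relation.Binary.PropositionalEquality using (_≡_; refl; sym; trans; cong; subst)
open import Relation.Nullary using (Dec; yes; no; ¬_; contradiction)
open import Relation.Nullary.Decidable using (False; fromSum; fromWitnessFalse; toWitnessFalse)

-- An isolated point x splits X as (X ∖ {x}) + 1. Conversely, isolatedness is
-- reflected along maps with a left inverse, and inj₂ tt is isolated in Y + 1.

inj₂-tt-isolated : ∀ {ℓ} {Y : Set ℓ} → isIsolated {X = Y ⊎ ⊤ {ℓ}} (inj₂ tt)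
inj₂-tt-isolated (inj₁ y)  = inj₂ λ ()
inj₂-tt-isolated (inj₂ tt) = inj₁ refl

isIsolated-reflect : ∀ {ℓ ℓ'} {X : Set ℓ} {Z : Set ℓ'} (f : X → Z) →
                     hasLeftInverse f → ∀ {x} → isIsolated (f x) → isIsolated x
isIsolated-reflect f (g , g∘f≗id) {x} fx-isolated y with fx-isolated (f y)
... | inj₁ fx≡fy = inj₁ (trans (sym (g∘f≗id x)) (trans (cong g fx≡fy) (g∘f≗id y)))
... | inj₂ fx≢fy = inj₂ (fx≢fy ∘ cong f)

module Complement {ℓ} {X : Set ℓ} {x : X} (x-isolated : isIsolated x) where

  _≟x : (y : X) → Dec (x ≡ y)
  y ≟x = fromSum (x-isolated y)

  -- False (y ≟x) rather than ¬ (x ≡ y): it is proof-irrelevant without funext,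
  -- which split∘unsplit needs.
  X∖x : Set ℓ
  X∖x = Σ X (λ y → False (y ≟x))

  split : X → X∖x ⊎ ⊤ {ℓ}
  split y with y ≟x
  ... | yes _    = inj₂ tt
  ... | no  x≢y  = inj₁ (y , fromWitnessFalse x≢y)

  unsplit : X∖x ⊎ ⊤ {ℓ} → X
  unsplit (inj₁ (y , _)) = y
  unsplit (inj₂ _)       = x

  unsplit∘split : (y : X) → unsplit (split y) ≡ y
  unsplit∘split y with y ≟x
  ... | yes x≡y = x≡y
  ... | no  _   = refl

  X∖x-≡ : {z z′ : X∖x} → proj₁ z ≡ proj₁ z′ → z ≡ z′
  X∖x-≡ {y , p} {.y , q} refl = cong (y ,_) (T-irrelevant p q)

  -- Stated up to X∖x-≡ because abstracting y ≟x inside (y , p) would be ill-typed.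
  split-≢ : {y : X} → ¬ (x ≡ y) → Σ X∖x (λ z → proj₁ z ≡ y × split y ≡ inj₁ z)
  split-≢ {y} x≢y with y ≟x
  ... | yes x≡y  = contradiction x≡y x≢y
  ... | no  x≢y′ = (y , fromWitnessFalse x≢y′) , refl , refl

  split∘unsplit : (z : X∖x ⊎ ⊤ {ℓ}) → split (unsplit z) ≡ z
  split∘unsplit (inj₁ (y , p)) with split-≢ (toWitnessFalse p)
  ... | z , z₁≡y , split-y≡z = trans split-y≡z (cong inj₁ (X∖x-≡ z₁≡y))
  split∘unsplit (inj₂ tt) with x ≟x
  ... | yes _   = refl
  ... | no  x≢x = contradiction refl x≢x

  split-x : split x ≡ inj₂ tt
  split-x = split∘unsplit (inj₂ tt)

  split-isEquiv : isEquiv split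
  split-isEquiv = (unsplit , unsplit∘split) , (unsplit , split∘unsplit)

lemma2p3 : ∀ {ℓ} (X : Set ℓ) (x : X) →
    isIsolated x ⇔
    Σ (Set ℓ) (λ Y → Σ (X → Y ⊎ ⊤ {ℓ}) (λ f → isEquiv f × (f x ≡ inj₂ tt)))
lemma2p3 {ℓ} X x = mk⇔ splitting isolated
  where
  splitting : isIsolated x →
              Σ (Set ℓ) (λ Y → Σ (X → Y ⊎ ⊤ {ℓ}) (λ f → isEquiv f × (f x ≡ inj₂ tt)))
  splitting x-isolated = X∖x , split , split-isEquiv , split-x
    where open Complement x-isolated

  isolated : Σ (Set ℓ) (λ Y → Σ (X → Y ⊎ ⊤ {ℓ}) (λ f → isEquiv f × (f x ≡ inj₂ tt))) →
             isIsolated x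
  isolated (_ , f , (f-retraction , _) , fx≡inj₂) =
    isIsolated-reflect f f-retraction (subst isIsolated (sym fx≡inj₂) inj₂-tt-isolated)
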